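{- Let $G_1$ and $G_2$ be graphs with $\chi(G_1)=k_1$, $\chi(G_2)=k_2$ and $k_1\le k_2$. Then for every integer $r$ with $r\le k_1+1$ (and $0<r\le \Delta(G_1+G_2)$), $\chi_r(G_1+G_2)=\chi(G_1+G_2)=k_1+k_2$.
   Context: All graphs are simple, connected and undirected. For a vertex $v$, $N_G(v)$ is its open neighborhood and $d(v)=|N_G(v)|$; $\Delta$ is the maximum degree. For a set $S$ of vertices and a coloring $c$, $c(S)=\{c(u):u\in S\}$. For integers $k>0$ and $0<r\le\Delta(G)$ with $r\le k$, a conditional $(k,r)$-coloring of $G$ is a surjective map $c:V(G)\to\{1,\dots,k\}$ such that (C1) $c(u)\ne c(v)$ whenever $uv\in E(G)$, and (C2) $|c(N_G(v))|\ge\min\{d(v),r\}$ for every vertex $v$. The $r$th order conditional chromatic number $\chi_r(G)$ is the smallest $k$ for which $G$ has a conditional $(k,r)$-coloring. The join $G_1+G_2$ has vertex set $V(G_1)\cup V(G_2)$ (disjoint) and edge set $E(G_1)\cup E(G_2)\cup\{u_1u_2: u_1\in V(G_1),u_2\in V(G_2)\}$. -}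

module Defs where

open import Data.Nat using (ℕ; zero; suc; _+_; _≤_; _<_; _⊔_; _⊓_)
open import Data.Fin using (Fin; splitAt; _≟_)
open import Data.List using (List; foldr; map; filter; length)
open import Data.Bool.ListAction using (any)
open import Data.List using () renaming (allFin to allFinL)
open import Data.Bool using (Bool; true; false; _∧_)
open import Data.Sum using (inj₁; inj₂)
open import Data.Product using (Σ; ∃; _×_; _,_)
open import Relation.Nullary using (¬_; does)
open import Relation.Binary.PropositionalEquality using (_≡_; _≢_)

record Graph : Set where
  constructor mkGraph
  field
    n   : ℕ
    adj : Fin n → Fin n → Bool
open Graph public

IsSimple : Graph → Set
IsSimple G = (∀ u v → adj G u v ≡ adj G v u) × (∀ v → adj G v v ≡ false)

data Reach (G : Graph) : Fin (n G) → Fin (n G) → Set where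
  here : ∀ {u} → Reach G u u
  step : ∀ {u w v} → adj G u w ≡ true → Reach G w v → Reach G u v

Connected : Graph → Set
Connected G = (0 < n G) × (∀ u v → Reach G u v)

deg : (G : Graph) → Fin (n G) → ℕ
deg G v = length (filter (λ u → adj G v u Data.Bool.≟ true) (allFinL (n G)))

maxDeg : Graph → ℕ
maxDeg G = foldr _⊔_ 0 (map (deg G) (allFinL (n G)))

nbColours : (G : Graph) {k : ℕ} → (Fin (n G) → Fin k) → Fin (n G) → ℕ
nbColours G {k} c v =
  length (filter (λ i → any (λ u → adj G v u ∧ does (c u ≟ i)) (allFinL (n G)) Data.Bool.≟ true)
                 (allFinL k))

Surjective : ∀ {a b} → (Fin a → Fin b) → Set
Surjective {b = b} c = ∀ (i : Fin b) → ∃ λ u → c u ≡ i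

Proper : (G : Graph) {k : ℕ} → (Fin (n G) → Fin k) → Set
Proper G c = ∀ u v → adj G u v ≡ true → c u ≢ c v

-- conditional (k,r)-colouring (including the standing requirement r ≤ k)
IsCondColouring : (G : Graph) (k r : ℕ) → (Fin (n G) → Fin k) → Set
IsCondColouring G k r c =
  (r ≤ k) × Surjective c × Proper G c × (∀ v → (deg G v ⊓ r) ≤ nbColours G c v)

IsCondChromNum : Graph → ℕ → ℕ → Set
IsCondChromNum G r k =
  (Σ (Fin (n G) → Fin k) λ c → IsCondColouring G k r c) ×
  (∀ k' (c : Fin (n G) → Fin k') → IsCondColouring G k' r c → k ≤ k')

IsChromNum : Graph → ℕ → Set
IsChromNum G k =
  (Σ (Fin (n G) → Fin k) λ c → Proper G c) ×
  (∀ k' (c : Fin (n G) → Fin k') → Proper G c → k ≤ k')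

join : Graph → Graph → Graph
join G₁ G₂ = mkGraph (n G₁ + n G₂) a
  where
  a : Fin (n G₁ + n G₂) → Fin (n G₁ + n G₂) → Bool
  a x y with splitAt (n G₁) x | splitAt (n G₁) y
  ... | inj₁ p | inj₁ q = adj G₁ p q
  ... | inj₂ p | inj₂ q = adj G₂ p q
  ... | inj₁ _ | inj₂ _ = true
  ... | inj₂ _ | inj₁ _ = true

-- Colours on the two sides of a join must be disjoint, and a proper colouring restricts to
-- each side, so χ(G₁ + G₂) ≥ χ(G₁) + χ(G₂); gluing minimal colourings with disjoint palettes
-- attains this.  Minimal colourings are surjective, so in the glued colouring a vertex of G₁
-- sees all k₂ colours of G₂ plus the colour of any neighbour inside G₁, i.e. at least
-- k₂ + 1 ≥ k₁ + 1 ≥ r colours (symmetrically k₁ + 1 on the G₂ side).  A vertex without a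
-- neighbour on its own side lives in a one-vertex graph; these cases are settled by χ ≤ 1
-- for one-vertex graphs, χ ≥ 2 in the presence of an edge, and d(v) ≤ 1 in K₁ + K₁.
module Submission where

open import Level using (Level; 0ℓ)
open import Defs
open import Data.Nat using (ℕ; zero; suc; _+_; _≤_; _<_; _⊓_; s≤s; s≤s⁻¹; >-nonZero⁻¹)
open import Data.Nat.Properties
  using (≤-trans; ≤-reflexive; <⇒≱; +-comm; +-suc; +-mono-≤; +-monoˡ-≤; +-monoʳ-≤; m⊓n≤m; m⊓n≤n; ≰⇒>; _≤?_; module ≤-Reasoning)
open import Data.Fin using (Fin; zero; suc; _↑ˡ_; _↑ʳ_; splitAt; _≟_; fromℕ<)
open import Data.Fin.Properties
  using (injective⇒≤; any?; nonZeroIndex; suc-injective; ↑ˡ-injective; ↑ʳ-injective; splitAt-↑ˡ; splitAt-↑ʳ)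
open import Data.List using (List; []; _∷_; filter; length; allFin)
open import Data.List.Properties using (filter-notAll; length-tabulate)
open import Data.List.Membership.Propositional using (_∈_; lose)
open import Data.List.Membership.Propositional.Properties using (∈-filter⁺; ∈-allFin)
open import Data.List.Membership.Setoid.Properties using (index-injective)
open import Data.List.Relation.Unary.Any using (index)
open import Data.List.Relation.Unary.Any.Properties using (any⁺)
open import Data.Bool using (true; false; _∧_) renaming (_≟_ to _≟ᵇ_)
open import Data.Bool.ListAction using (any)
open import Data.Bool.Properties using (T-≡; T-∧)
open import Data.Product using (∃; _×_; _,_; proj₁; proj₂)
open import Data.Sum using (_⊎_; inj₁; inj₂; [_,_]′)
open import Function using (_∘_; Injective; Equivalence)
open import Relation.Nullary using (yes; no; does; contradiction)
open import Relation.Nullary.Decidable using (dec-true)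
open import Relation.Unary using (Pred; Decidable; ∁)
open import Relation.Unary.Properties using (∁?)
open import Relation.Binary.PropositionalEquality
  using (_≡_; _≢_; refl; sym; trans; cong; setoid)

private
  variable
    m k : ℕ
    A : Set
    ℓ : Level

true≢false : true ≢ false
true≢false ()

injection⇒≤length : {f : Fin m → A} {xs : List A} → Injective _≡_ _≡_ f → (∀ j → f j ∈ xs) → m ≤ length xs
injection⇒≤length {A = A} inj f∈ = injective⇒≤ (λ {i} {j} eq → inj (index-injective (setoid A) (f∈ i) (f∈ j) eq))

length-filter-∁ : {P : Pred A ℓ} (P? : Decidable P) (xs : List A) →
  length (filter P? xs) + length (filter (∁? P?) xs) ≡ length xs
length-filter-∁ P? [] = refl
length-filter-∁ P? (x ∷ xs) with P? x
... | yes _ = cong suc (length-filter-∁ P? xs)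
... | no _  = trans (+-suc _ _) (cong suc (length-filter-∁ P? xs))

length-allFin : ∀ k → length (allFin k) ≡ k
length-allFin k = length-tabulate (λ i → i)

≤1⇒Fin-irrelevant : k ≤ 1 → (i j : Fin k) → i ≡ j
≤1⇒Fin-irrelevant {suc zero}    _           zero zero = refl
≤1⇒Fin-irrelevant {suc (suc _)} (s≤s ())    _    _

Fin⇒1≤ : Fin k → 1 ≤ k
Fin⇒1≤ {k} i = >-nonZero⁻¹ k {{nonZeroIndex i}}

Image : (Fin m → Fin k) → Pred (Fin k) 0ℓ
Image f i = ∃ λ u → f u ≡ i

image? : (f : Fin m → Fin k) → Decidable (Image f)
image? f i = any? (λ u → f u ≟ i)

∈-image : (f : Fin m → Fin k) (u : Fin m) → f u ∈ filter (image? f) (allFin k)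
∈-image f u = ∈-filter⁺ (image? f) (∈-allFin (f u)) (u , refl)

module _ {G : Graph} where

  χ≤length : {k k′ : ℕ} {c : Fin (n G) → Fin k′} {cs : List (Fin k′)} →
    IsChromNum G k → Proper G c → (∀ u → c u ∈ cs) → k ≤ length cs
  χ≤length {k′ = k′} (_ , minimal) proper c∈ =
    minimal _ (index ∘ c∈) (λ u v uv eq → proper u v uv (index-injective (setoid (Fin k′)) (c∈ u) (c∈ v) eq))

  -- A colour missing from the image could be squeezed out, contradicting minimality.
  χ-colouring-surjective : {c : Fin (n G) → Fin k} → IsChromNum G k → Proper G c → Surjective c
  χ-colouring-surjective {k} {c} χ proper i with image? c i
  ... | yes used = used
  ... | no unused = contradiction (χ≤length χ proper (∈-image c)) (<⇒≱ fewer)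
    where
    fewer : length (filter (image? c) (allFin k)) < k
    fewer = ≤-trans (filter-notAll (image? c) (allFin k) (lose (∈-allFin i) unused)) (≤-reflexive (length-allFin k))

  proper-edge⇒2≤ : {c : Fin (n G) → Fin k} {u v : Fin (n G)} → Proper G c → adj G u v ≡ true → 2 ≤ k
  proper-edge⇒2≤ {k} {c} {u} {v} proper uv with 2 ≤? k
  ... | yes 2≤k = 2≤k
  ... | no 2≰k = contradiction (≤1⇒Fin-irrelevant (s≤s⁻¹ (≰⇒> 2≰k)) (c u) (c v)) (proper u v uv)

  trivial⇒χ≤1 : IsSimple G → n G ≤ 1 → IsChromNum G k → k ≤ 1
  trivial⇒χ≤1 (_ , loopless) n≤1 (_ , minimal) = minimal 1 (λ _ → zero) edgeless
    where
    edgeless : Proper G (λ _ → zero)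
    edgeless u v uv _ with ≤1⇒Fin-irrelevant n≤1 u v
    ... | refl = true≢false (trans (sym uv) (loopless u))

  connected⇒trivial⊎neighbour : Connected G → n G ≤ 1 ⊎ (∀ u → ∃ λ w → adj G u w ≡ true)
  connected⇒trivial⊎neighbour (_ , reach) with n G ≤? 1
  ... | yes n≤1 = inj₁ n≤1
  ... | no n≰1 = inj₂ λ u → neighbour u (other (≰⇒> n≰1) u)
    where
    other : 2 ≤ m → (u : Fin m) → ∃ λ w → u ≢ w
    other (s≤s (s≤s _)) zero    = suc zero , λ ()
    other (s≤s (s≤s _)) (suc _) = zero , λ ()
    neighbour : ∀ u → (∃ λ w → u ≢ w) → ∃ λ w → adj G u w ≡ true
    neighbour u (w , u≢w) with reach u w
    ... | here = contradiction refl u≢w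
    ... | step uw _ = _ , uw

  deg<n : ∀ {v} → adj G v v ≡ false → deg G v < n G
  deg<n {v} noLoop = ≤-trans (filter-notAll P? (allFin (n G)) (lose (∈-allFin v) v∉N[v])) (≤-reflexive (length-allFin (n G)))
    where
    P? = λ u → adj G v u ≟ᵇ true
    v∉N[v] : adj G v v ≢ true
    v∉N[v] vv = true≢false (trans (sym vv) noLoop)

  InNeighbourhood : {k : ℕ} → (Fin (n G) → Fin k) → Fin (n G) → Fin k → Set
  InNeighbourhood c x i = ∃ λ y → adj G x y ≡ true × c y ≡ i

  nbColours-≥ : {c : Fin (n G) → Fin k} {x : Fin (n G)} {f : Fin m → Fin k} →
    Injective _≡_ _≡_ f → (∀ j → InNeighbourhood c x (f j)) → m ≤ nbColours G c x
  nbColours-≥ {c = c} {x} {f} inj seen = injection⇒≤length inj λ j → ∈-filter⁺ _ (∈-allFin (f j)) (counted (seen j))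
    where
    counted : ∀ {i} → InNeighbourhood c x i → any (λ u → adj G x u ∧ does (c u ≟ i)) (allFin (n G)) ≡ true
    counted (y , xy , cy) = Equivalence.to T-≡ (any⁺ _ (lose (∈-allFin y) y-counted))
      where
      y-counted = Equivalence.from T-∧ (Equivalence.from T-≡ xy , Equivalence.from T-≡ (dec-true (c y ≟ _) cy))

  nbColours-≥-suc : {c : Fin (n G) → Fin k} {x y : Fin (n G)} {f : Fin m → Fin k} →
    Injective _≡_ _≡_ f → (∀ j → InNeighbourhood c x (f j)) →
    adj G x y ≡ true → (∀ j → f j ≢ c y) → suc m ≤ nbColours G c x
  nbColours-≥-suc {c = c} {y = y} {f} inj seen xy fresh = nbColours-≥ inj′ seen′
    where
    f′ : Fin (suc _) → Fin _
    f′ zero    = c y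
    f′ (suc j) = f j
    inj′ : Injective _≡_ _≡_ f′
    inj′ {zero}  {zero}  _  = refl
    inj′ {zero}  {suc j} eq = contradiction (sym eq) (fresh j)
    inj′ {suc i} {zero}  eq = contradiction eq (fresh i)
    inj′ {suc i} {suc j} eq = cong suc (inj eq)
    seen′ : ∀ j → InNeighbourhood c _ (f′ j)
    seen′ zero    = y , xy , refl
    seen′ (suc j) = seen j

↑ˡ≢↑ʳ : ∀ {a b} (i : Fin a) (j : Fin b) → i ↑ˡ b ≢ a ↑ʳ j
↑ˡ≢↑ʳ zero    j ()
↑ˡ≢↑ʳ (suc i) j eq = ↑ˡ≢↑ʳ i j (suc-injective eq)

data SplitView (a b : ℕ) : Fin (a + b) → Set where
  inˡ : (i : Fin a) → SplitView a b (i ↑ˡ b)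
  inʳ : (j : Fin b) → SplitView a b (a ↑ʳ j)

splitView : ∀ a {b} (x : Fin (a + b)) → SplitView a b x
splitView zero    x       = inʳ x
splitView (suc a) zero    = inˡ zero
splitView (suc a) (suc x) with splitView a x
... | inˡ i = inˡ (suc i)
... | inʳ j = inʳ j

module JoinOf (G₁ G₂ : Graph) where

  private
    J = join G₁ G₂
    variable
      k₁ k₂ : ℕ

  left : Fin (n G₁) → Fin (n J)
  left u = u ↑ˡ n G₂

  right : Fin (n G₂) → Fin (n J)
  right v = n G₁ ↑ʳ v

  adj-left-left : ∀ u v → adj J (left u) (left v) ≡ adj G₁ u v
  adj-left-left u v rewrite splitAt-↑ˡ (n G₁) u (n G₂) | splitAt-↑ˡ (n G₁) v (n G₂) = refl

  adj-right-right : ∀ u v → adj J (right u) (right v) ≡ adj G₂ u v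
  adj-right-right u v rewrite splitAt-↑ʳ (n G₁) (n G₂) u | splitAt-↑ʳ (n G₁) (n G₂) v = refl

  adj-left-right : ∀ u v → adj J (left u) (right v) ≡ true
  adj-left-right u v rewrite splitAt-↑ˡ (n G₁) u (n G₂) | splitAt-↑ʳ (n G₁) (n G₂) v = refl

  adj-right-left : ∀ u v → adj J (right u) (left v) ≡ true
  adj-right-left u v rewrite splitAt-↑ʳ (n G₁) (n G₂) u | splitAt-↑ˡ (n G₁) v (n G₂) = refl

  join-loopless : IsSimple G₁ → IsSimple G₂ → ∀ x → adj J x x ≡ false
  join-loopless (_ , loopless₁) (_ , loopless₂) x with splitView (n G₁) x
  ... | inˡ u = trans (adj-left-left u u) (loopless₁ u)
  ... | inʳ v = trans (adj-right-right v v) (loopless₂ v)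

  trivial-join-deg≤1 : IsSimple G₁ → IsSimple G₂ → n G₁ ≤ 1 → n G₂ ≤ 1 → ∀ x → deg J x ≤ 1
  trivial-join-deg≤1 simple₁ simple₂ n₁≤1 n₂≤1 x =
    s≤s⁻¹ (≤-trans (deg<n {J} (join-loopless simple₁ simple₂ x)) (+-mono-≤ n₁≤1 n₂≤1))

  join-colours-≥ : IsChromNum G₁ k₁ → IsChromNum G₂ k₂ → {c : Fin (n J) → Fin k} → Proper J c → k₁ + k₂ ≤ k
  join-colours-≥ {k₁} {k₂} {k} χ₁ χ₂ {c} proper = begin
    k₁ + k₂
      ≤⟨ +-mono-≤ (χ≤length χ₁ properˡ (∈-image (c ∘ left))) (χ≤length χ₂ properʳ ∈-∁image) ⟩
    length (filter P? (allFin k)) + length (filter (∁? P?) (allFin k))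
      ≡⟨ length-filter-∁ P? (allFin k) ⟩
    length (allFin k)
      ≡⟨ length-allFin k ⟩
    k ∎
    where
    open ≤-Reasoning
    P? = image? (c ∘ left)
    properˡ : Proper G₁ (c ∘ left)
    properˡ u v uv = proper (left u) (left v) (trans (adj-left-left u v) uv)
    properʳ : Proper G₂ (c ∘ right)
    properʳ u v uv = proper (right u) (right v) (trans (adj-right-right u v) uv)
    ∈-∁image : ∀ v → c (right v) ∈ filter (∁? P?) (allFin k)
    ∈-∁image v = ∈-filter⁺ (∁? P?) (∈-allFin _) λ (u , eq) → proper (left u) (right v) (adj-left-right u v) eq

  _⊕_ : (Fin (n G₁) → Fin k₁) → (Fin (n G₂) → Fin k₂) → Fin (n J) → Fin (k₁ + k₂)
  _⊕_ {k₁} {k₂} c₁ c₂ x = [ (λ u → c₁ u ↑ˡ k₂) , (λ v → k₁ ↑ʳ c₂ v) ]′ (splitAt (n G₁) x)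

  module _ {k₁ k₂ : ℕ} {c₁ : Fin (n G₁) → Fin k₁} {c₂ : Fin (n G₂) → Fin k₂} where

    ⊕-left : ∀ u → (c₁ ⊕ c₂) (left u) ≡ c₁ u ↑ˡ k₂
    ⊕-left u rewrite splitAt-↑ˡ (n G₁) u (n G₂) = refl

    ⊕-right : ∀ v → (c₁ ⊕ c₂) (right v) ≡ k₁ ↑ʳ c₂ v
    ⊕-right v rewrite splitAt-↑ʳ (n G₁) (n G₂) v = refl

    ⊕-proper : Proper G₁ c₁ → Proper G₂ c₂ → Proper J (c₁ ⊕ c₂)
    ⊕-proper proper₁ proper₂ x y xy eq with splitView (n G₁) x | splitView (n G₁) y
    ... | inˡ u | inˡ v = proper₁ u v (trans (sym (adj-left-left u v)) xy)
                            (↑ˡ-injective k₂ _ _ (trans (sym (⊕-left u)) (trans eq (⊕-left v))))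
    ... | inʳ u | inʳ v = proper₂ u v (trans (sym (adj-right-right u v)) xy)
                            (↑ʳ-injective k₁ _ _ (trans (sym (⊕-right u)) (trans eq (⊕-right v))))
    ... | inˡ u | inʳ v = ↑ˡ≢↑ʳ _ _ (trans (sym (⊕-left u)) (trans eq (⊕-right v)))
    ... | inʳ u | inˡ v = ↑ˡ≢↑ʳ _ _ (trans (sym (⊕-left v)) (trans (sym eq) (⊕-right u)))

    ⊕-surjective : Surjective c₁ → Surjective c₂ → Surjective (c₁ ⊕ c₂)
    ⊕-surjective onto₁ onto₂ i with splitView k₁ i
    ... | inˡ j = let (u , cu) = onto₁ j in left u , trans (⊕-left u) (cong (_↑ˡ k₂) cu)
    ... | inʳ j = let (v , cv) = onto₂ j in right v , trans (⊕-right v) (cong (k₁ ↑ʳ_) cv)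

    right-colours-around-left : Surjective c₂ → ∀ u j → InNeighbourhood {J} (c₁ ⊕ c₂) (left u) (k₁ ↑ʳ j)
    right-colours-around-left onto₂ u j =
      let (v , cv) = onto₂ j in right v , adj-left-right u v , trans (⊕-right v) (cong (k₁ ↑ʳ_) cv)

    left-colours-around-right : Surjective c₁ → ∀ v j → InNeighbourhood {J} (c₁ ⊕ c₂) (right v) (j ↑ˡ k₂)
    left-colours-around-right onto₁ v j =
      let (u , cu) = onto₁ j in left u , adj-right-left v u , trans (⊕-left u) (cong (_↑ˡ k₂) cu)

    nbColours-left : Surjective c₂ → ∀ u → k₂ ≤ nbColours J (c₁ ⊕ c₂) (left u)
    nbColours-left onto₂ u = nbColours-≥ {J} (↑ʳ-injective k₁ _ _) (right-colours-around-left onto₂ u)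

    nbColours-right : Surjective c₁ → ∀ v → k₁ ≤ nbColours J (c₁ ⊕ c₂) (right v)
    nbColours-right onto₁ v = nbColours-≥ {J} (↑ˡ-injective k₂ _ _) (left-colours-around-right onto₁ v)

    nbColours-left-suc : Surjective c₂ → ∀ {u w} → adj G₁ u w ≡ true → suc k₂ ≤ nbColours J (c₁ ⊕ c₂) (left u)
    nbColours-left-suc onto₂ {u} {w} uw =
      nbColours-≥-suc {J} (↑ʳ-injective k₁ _ _) (right-colours-around-left onto₂ u) (trans (adj-left-left u w) uw)
        (λ j eq → ↑ˡ≢↑ʳ _ _ (sym (trans eq (⊕-left w))))

    nbColours-right-suc : Surjective c₁ → ∀ {v w} → adj G₂ v w ≡ true → suc k₁ ≤ nbColours J (c₁ ⊕ c₂) (right v)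
    nbColours-right-suc onto₁ {v} {w} vw =
      nbColours-≥-suc {J} (↑ˡ-injective k₂ _ _) (left-colours-around-right onto₁ v) (trans (adj-right-right v w) vw)
        (λ j eq → ↑ˡ≢↑ʳ _ _ (trans eq (⊕-right w)))

  module Gluing (simple₁ : IsSimple G₁) (simple₂ : IsSimple G₂) (conn₁ : Connected G₁) (conn₂ : Connected G₂)
           {k₁ k₂ : ℕ} (χ₁ : IsChromNum G₁ k₁) (χ₂ : IsChromNum G₂ k₂) where

    private
      c₁ = proj₁ (proj₁ χ₁)
      c₂ = proj₁ (proj₁ χ₂)
      proper₁ = proj₂ (proj₁ χ₁)
      proper₂ = proj₂ (proj₁ χ₂)
      onto₁ = χ-colouring-surjective χ₁ proper₁
      onto₂ = χ-colouring-surjective χ₂ proper₂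
      u₀ = fromℕ< (proj₁ conn₁)
      v₀ = fromℕ< (proj₁ conn₂)
      open ≤-Reasoning

    glued : Fin (n J) → Fin (k₁ + k₂)
    glued = c₁ ⊕ c₂

    glued-proper : Proper J glued
    glued-proper = ⊕-proper proper₁ proper₂

    glued-surjective : Surjective glued
    glued-surjective = ⊕-surjective onto₁ onto₂

    glued-condition-left : ∀ {r} → k₁ ≤ k₂ → r ≤ k₁ + 1 → ∀ u → deg J (left u) ⊓ r ≤ nbColours J glued (left u)
    glued-condition-left {r} k₁≤k₂ r≤ u with connected⇒trivial⊎neighbour conn₁
    ... | inj₂ around₁ = begin
      deg J (left u) ⊓ r          ≤⟨ m⊓n≤n _ r ⟩
      r                           ≤⟨ r≤ ⟩
      k₁ + 1                      ≤⟨ +-monoˡ-≤ 1 k₁≤k₂ ⟩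
      k₂ + 1                      ≡⟨ +-comm k₂ 1 ⟩
      suc k₂                      ≤⟨ nbColours-left-suc {c₁ = c₁} onto₂ (proj₂ (around₁ u)) ⟩
      nbColours J glued (left u)  ∎
    ... | inj₁ trivial₁ with connected⇒trivial⊎neighbour conn₂
    ...   | inj₂ around₂ = begin
      deg J (left u) ⊓ r          ≤⟨ m⊓n≤n _ r ⟩
      r                           ≤⟨ r≤ ⟩
      k₁ + 1                      ≤⟨ +-monoˡ-≤ 1 (trivial⇒χ≤1 simple₁ trivial₁ χ₁) ⟩
      2                           ≤⟨ proper-edge⇒2≤ proper₂ (proj₂ (around₂ v₀)) ⟩
      k₂                          ≤⟨ nbColours-left {c₁ = c₁} onto₂ u ⟩
      nbColours J glued (left u)  ∎
    ...   | inj₁ trivial₂ = begin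
      deg J (left u) ⊓ r          ≤⟨ m⊓n≤m _ r ⟩
      deg J (left u)              ≤⟨ trivial-join-deg≤1 simple₁ simple₂ trivial₁ trivial₂ (left u) ⟩
      1                           ≤⟨ Fin⇒1≤ (c₂ v₀) ⟩
      k₂                          ≤⟨ nbColours-left {c₁ = c₁} onto₂ u ⟩
      nbColours J glued (left u)  ∎

    glued-condition-right : ∀ {r} → k₁ ≤ k₂ → r ≤ k₁ + 1 → ∀ v → deg J (right v) ⊓ r ≤ nbColours J glued (right v)
    glued-condition-right {r} k₁≤k₂ r≤ v with connected⇒trivial⊎neighbour conn₂
    ... | inj₂ around₂ = begin
      deg J (right v) ⊓ r         ≤⟨ m⊓n≤n _ r ⟩
      r                           ≤⟨ r≤ ⟩
      k₁ + 1                      ≡⟨ +-comm k₁ 1 ⟩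
      suc k₁                      ≤⟨ nbColours-right-suc {c₂ = c₂} onto₁ (proj₂ (around₂ v)) ⟩
      nbColours J glued (right v) ∎
    ... | inj₁ trivial₂ with connected⇒trivial⊎neighbour conn₁
    ...   | inj₂ around₁ = contradiction
      (≤-trans (proper-edge⇒2≤ proper₁ (proj₂ (around₁ u₀))) (≤-trans k₁≤k₂ (trivial⇒χ≤1 simple₂ trivial₂ χ₂)))
      (λ { (s≤s ()) })
    ...   | inj₁ trivial₁ = begin
      deg J (right v) ⊓ r         ≤⟨ m⊓n≤m _ r ⟩
      deg J (right v)             ≤⟨ trivial-join-deg≤1 simple₁ simple₂ trivial₁ trivial₂ (right v) ⟩
      1                           ≤⟨ Fin⇒1≤ (c₁ u₀) ⟩
      k₁                          ≤⟨ nbColours-right {c₂ = c₂} onto₁ v ⟩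
      nbColours J glued (right v) ∎

    glued-condition : ∀ {r} → k₁ ≤ k₂ → r ≤ k₁ + 1 → ∀ x → deg J x ⊓ r ≤ nbColours J glued x
    glued-condition k₁≤k₂ r≤ x with splitView (n G₁) x
    ... | inˡ u = glued-condition-left k₁≤k₂ r≤ u
    ... | inʳ v = glued-condition-right k₁≤k₂ r≤ v

-- 0 < r and r ≤ Δ are standing conventions of the definition; the argument does not use them.
theorem2p1 : (G₁ G₂ : Graph) → IsSimple G₁ → IsSimple G₂ → Connected G₁ → Connected G₂ →
    (k₁ k₂ : ℕ) → IsChromNum G₁ k₁ → IsChromNum G₂ k₂ → k₁ ≤ k₂ →
    (r : ℕ) → 0 < r → r ≤ maxDeg (join G₁ G₂) → r ≤ k₁ + 1 →
    IsCondChromNum (join G₁ G₂) r (k₁ + k₂) × IsChromNum (join G₁ G₂) (k₁ + k₂)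
theorem2p1 G₁ G₂ simple₁ simple₂ conn₁ conn₂ k₁ k₂ χ₁ χ₂ k₁≤k₂ r _ _ r≤k₁+1 =
  ( (glued , r≤k₁+k₂ , glued-surjective , glued-proper , glued-condition k₁≤k₂ r≤k₁+1)
  , λ _ _ (_ , _ , proper , _) → join-colours-≥ χ₁ χ₂ proper )
  , ((glued , glued-proper) , λ _ _ → join-colours-≥ χ₁ χ₂)
  where
  open JoinOf G₁ G₂
  open Gluing simple₁ simple₂ conn₁ conn₂ χ₁ χ₂
  r≤k₁+k₂ : r ≤ k₁ + k₂
  r≤k₁+k₂ = ≤-trans r≤k₁+1 (+-monoʳ-≤ k₁ (Fin⇒1≤ (proj₁ (proj₁ χ₂) (fromℕ< (proj₁ conn₂)))))
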